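{- Let $M=(a_{i,j})_{1\leq i,j\leq n}$ be a Steinhaus matrix of size $n\geq3$. Then the following are equivalent: (i) $M$ is doubly-symmetric; (ii) the over-diagonal $(a_{1,2},a_{2,3},\ldots,a_{n-1,n})$ of $M$ is a symmetric sequence, i.e. $a_{i,i+1}=a_{n-i,n-i+1}$ for all $1\leq i\leq n-1$; (iii) $a_{i,n-i+1}=0$ for all $1\leq i\leq \left\lfloor \frac{n-1}{2}\right\rfloor$.
   Context: A Steinhaus matrix of size $n\geq1$ is a matrix $M=(a_{i,j})_{1\leq i,j\leq n}$ with entries in $\mathbb{F}_2=\{0,1\}$ such that $a_{i,i}=0$ for all $i$, $a_{i,j}=a_{i-1,j-1}+a_{i-1,j}$ (addition in $\mathbb{F}_2$) for all $2\leq i<j\leq n$, and $a_{i,j}=a_{j,i}$ for all $i,j$. A square matrix $(a_{i,j})$ of size $n$ is doubly-symmetric if $a_{i,j}=a_{j,i}=a_{n-j+1,n-i+1}$ for all $1\leq i,j\leq n$. -}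

module Defs where

open import Data.Nat using (ℕ; suc; _+_; _∸_; _≤_; _<_; _/_)
open import Data.Bool using (Bool; false; _xor_)
open import Data.Product using (_×_)
open import Relation.Binary.PropositionalEquality using (_≡_)

-- Entries in F₂ are represented by Bool (false = 0, true = 1, addition = xor).
-- A square matrix of size n is a function ℕ → ℕ → Bool, of which only the
-- entries a i j with 1 ≤ i, j ≤ n are meaningful (1-based indices as in the paper).
Matrix : Set
Matrix = ℕ → ℕ → Bool

record IsSteinhaus (n : ℕ) (a : Matrix) : Set where
  field
    diag : ∀ i → 1 ≤ i → i ≤ n → a i i ≡ false
    rule : ∀ i j → 2 ≤ i → i < j → j ≤ n →
           a i j ≡ (a (i ∸ 1) (j ∸ 1) xor a (i ∸ 1) j)
    symm : ∀ i j → 1 ≤ i → i ≤ n → 1 ≤ j → j ≤ n → a i j ≡ a j i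

DoublySymmetric : ℕ → Matrix → Set
DoublySymmetric n a =
  ∀ i j → 1 ≤ i → i ≤ n → 1 ≤ j → j ≤ n →
    (a i j ≡ a j i) × (a j i ≡ a (n ∸ j + 1) (n ∸ i + 1))

SymmetricOverDiagonal : ℕ → Matrix → Set
SymmetricOverDiagonal n a =
  ∀ i → 1 ≤ i → i ≤ n ∸ 1 → a i (i + 1) ≡ a (n ∸ i) (n ∸ i + 1)

AntiDiagonalZero : ℕ → Matrix → Set
AntiDiagonalZero n a =
  ∀ i → 1 ≤ i → i ≤ (n ∸ 1) / 2 → a i (n ∸ i + 1) ≡ false

-- Read the d-th superdiagonal of a Steinhaus matrix as a binary sequence. The Steinhaus rule
-- says that diagonal d + 1 is the difference sequence (over F₂) of diagonal d. Differencing
-- preserves palindromes, and conversely a sequence is a palindrome as soon as its difference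
-- sequence is a palindrome vanishing at its centre; the centres of the diagonals are exactly
-- the antidiagonal entries a i (n - i + 1). So a palindromic over-diagonal makes every
-- diagonal palindromic, which together with a i j = a j i is double symmetry and forces the
-- antidiagonal zeros; conversely the antidiagonal zeros carry the palindrome property back
-- from the one-entry diagonal (a 1 n) down to the over-diagonal.
module Submission where

open import Defs
open import Algebra.Bundles using (CommutativeRing)
open import Data.Bool using (Bool; false; _xor_)
open import Data.Bool.Properties using (xor-comm; xor-assoc; xor-same; xor-∧-commutativeRing)
open import Algebra.Properties.Group (CommutativeRing.+-group xor-∧-commutativeRing)
  using (∙-cancelˡ; ∙-cancelʳ)
open import Data.Nat using (ℕ; zero; suc; _+_; _∸_; _*_; _/_; _≤_; _<_; z≤n; s≤s)
open import Data.Nat.Properties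
open import Data.Nat.DivMod using (m/n*n≤m; m*n/n≡m; /-monoˡ-≤)
open import Data.Nat.Tactic.RingSolver using (solve-∀)
open import Data.Product using (_×_; _,_; ∃; proj₁; proj₂)
open import Data.Sum using (inj₁; inj₂)
open import Function.Base using (_∘_)
open import Function.Bundles using (_⇔_; mk⇔)
open import Relation.Binary.Definitions using (Tri; tri<; tri≈; tri>)
open import Relation.Binary.PropositionalEquality
open ≡-Reasoning

Palindromic : ℕ → (ℕ → Bool) → Set
Palindromic m f = ∀ i j → i + j ≡ m → f i ≡ f j

IsDifferenceOn : ℕ → (ℕ → Bool) → (ℕ → Bool) → Set
IsDifferenceOn m b c = ∀ i → i ≤ m → c i ≡ b i xor b (suc i)

VanishesAtCentre : ℕ → (ℕ → Bool) → Set
VanishesAtCentre m c = ∀ i → i + i ≡ m → c i ≡ false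

palindromic-zero : ∀ f → Palindromic 0 f
palindromic-zero f zero zero _ = refl

palindromic-≤ : ∀ {m f} → (∀ i j → i ≤ j → i + j ≡ m → f i ≡ f j) → Palindromic m f
palindromic-≤ h i j e with ≤-total i j
... | inj₁ i≤j = h i j i≤j e
... | inj₂ j≤i = sym (h j i j≤i (trans (+-comm j i) e))

module _ {m : ℕ} {b c : ℕ → Bool} (c≡Δb : IsDifferenceOn m b c) where

  palindromic-difference : Palindromic (suc m) b → Palindromic m c
  palindromic-difference pal i j refl = begin
    c i                ≡⟨ c≡Δb i (m≤m+n i j) ⟩
    b i xor b (suc i)  ≡⟨ cong₂ _xor_ (pal i (suc j) (+-suc i j)) (pal (suc i) j refl) ⟩
    b (suc j) xor b j  ≡⟨ xor-comm (b (suc j)) (b j) ⟩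
    b j xor b (suc j)  ≡⟨ c≡Δb j (m≤n+m j i) ⟨
    c j                ∎

  palindromic-centre : Palindromic (suc m) b → VanishesAtCentre m c
  palindromic-centre pal i refl = begin
    c i                ≡⟨ c≡Δb i (m≤m+n i i) ⟩
    b i xor b (suc i)  ≡⟨ cong (_xor b (suc i)) (pal i (suc i) (+-suc i i)) ⟩
    b (suc i) xor b (suc i) ≡⟨ xor-same (b (suc i)) ⟩
    false              ∎

  -- Walking inwards from both ends: b i ≡ b j follows from b (suc i) ≡ b (j ∸ 1) and
  -- c i ≡ c (j ∸ 1); at the centre either i ≡ j or c i ≡ false.
  palindromic-integrate : Palindromic m c → VanishesAtCentre m c → Palindromic (suc m) b
  palindromic-integrate pal centre =
    palindromic-≤ λ i j i≤j → walk (j ∸ i) i j (m∸n+n≡m i≤j)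
    where
    walk : ∀ k i j → k + i ≡ j → i + j ≡ suc m → b i ≡ b j
    walk zero i .i refl _ = refl
    walk (suc zero) i .(suc i) refl e = ∙-cancelˡ (b i) (b i) (b (suc i)) (begin
      b i xor b i        ≡⟨ xor-same (b i) ⟩
      false              ≡⟨ centre i i+i≡m ⟨
      c i                ≡⟨ c≡Δb i (m+n≤o⇒m≤o i (≤-reflexive i+i≡m)) ⟩
      b i xor b (suc i)  ∎)
      where
      i+i≡m : i + i ≡ m
      i+i≡m = suc-injective (trans (sym (+-suc i i)) e)
    walk (suc (suc k)) i .(suc (suc (k + i))) refl e = ∙-cancelʳ (b (suc i)) (b i) (b j) (begin
      b i xor b (suc i)  ≡⟨ c≡Δb i (m+n≤o⇒m≤o i (≤-reflexive i+j′≡m)) ⟨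
      c i                ≡⟨ pal i j′ i+j′≡m ⟩
      c j′               ≡⟨ c≡Δb j′ (m+n≤o⇒n≤o i (≤-reflexive i+j′≡m)) ⟩
      b j′ xor b j       ≡⟨ cong (_xor b j) (walk k (suc i) j′ (+-suc k i) (cong suc i+j′≡m)) ⟨
      b (suc i) xor b j  ≡⟨ xor-comm (b (suc i)) (b j) ⟩
      b j xor b (suc i)  ∎)
      where
      j′ j : ℕ
      j′ = suc (k + i)
      j = suc j′
      i+j′≡m : i + j′ ≡ m
      i+j′≡m = suc-injective (trans (sym (+-suc i j′)) e)

m+n∸m+1≡1+n : ∀ m n → m + n ∸ m + 1 ≡ suc n
m+n∸m+1≡1+n m n = trans (cong (_+ 1) (m+n∸m≡n m n)) (+-comm n 1)

reflect-bounds : ∀ {i n} → 1 ≤ i → i ≤ n → 1 ≤ n ∸ i + 1 × n ∸ i + 1 ≤ n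
reflect-bounds {suc i} {suc n} _ _ =
  m≤n+m 1 (n ∸ i) , ≤-trans (≤-reflexive (+-comm (n ∸ i) 1)) (s≤s (m∸n≤m n i))

*2≤⇒≤/2 : ∀ i m → i * 2 ≤ m → i ≤ m / 2
*2≤⇒≤/2 i m le = subst (_≤ m / 2) (m*n/n≡m i 2) (/-monoˡ-≤ 2 le)

≤/2⇒*2≤ : ∀ i m → i ≤ m / 2 → i * 2 ≤ m
≤/2⇒*2≤ i m le = ≤-trans (*-monoˡ-≤ 2 le) (m/n*n≤m m 2)

-- Row suc p meets the antidiagonal in the centre of the diagonal of offset suc (suc e),
-- where n ≡ suc e + suc (suc (p + p)).
antidiagonal-row : ∀ {p n} → suc p ≤ (n ∸ 1) / 2 → ∃ λ e → suc e + suc (suc (p + p)) ≡ n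
antidiagonal-row {p} {n} le with m≤n⇒∃[o]m+o≡n (≤/2⇒*2≤ (suc p) (n ∸ 1) le)
antidiagonal-row {p} {suc n} _ | e , refl = e , cong suc (regroup p e)
  where
  regroup : ∀ p e → e + suc (suc (p + p)) ≡ suc p * 2 + e
  regroup = solve-∀

antidiagonal-row⁻¹ : ∀ e p → suc p ≤ (suc e + suc (suc (p + p)) ∸ 1) / 2
antidiagonal-row⁻¹ e p = *2≤⇒≤/2 (suc p) _ (≤-trans (m≤m+n (suc p * 2) e) (≤-reflexive (regroup p e)))
  where
  regroup : ∀ p e → suc p * 2 + e ≡ e + suc (suc (p + p))
  regroup = solve-∀

antidiagonal-column : ∀ e p → suc e + suc (suc (p + p)) ∸ suc p + 1 ≡ suc p + suc (suc e)
antidiagonal-column e p = begin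
  suc e + suc (suc (p + p)) ∸ suc p + 1  ≡⟨ cong (λ x → x ∸ suc p + 1) (split-n e p) ⟩
  suc p + suc (e + suc p) ∸ suc p + 1    ≡⟨ m+n∸m+1≡1+n (suc p) (suc (e + suc p)) ⟩
  suc (suc (e + suc p))                  ≡⟨ regroup e p ⟩
  suc p + suc (suc e)                    ∎
  where
  split-n : ∀ e p → suc e + suc (suc (p + p)) ≡ suc p + suc (e + suc p)
  split-n = solve-∀
  regroup : ∀ e p → suc (suc (e + suc p)) ≡ suc p + suc (suc e)
  regroup = solve-∀

-- The entries a (suc i) (suc i + d), i ≡ 0 … m, of the d-th superdiagonal, where d + suc m ≡ n.
diagonal : Matrix → ℕ → ℕ → Bool
diagonal a d i = a (suc i) (suc i + d)

PalindromicDiagonals : ℕ → Matrix → Set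
PalindromicDiagonals n a = ∀ d m → 1 ≤ d → d + suc m ≡ n → Palindromic m (diagonal a d)

private
  variable
    n : ℕ
    a : Matrix

sod⇒palindromic-diagonal₁ : SymmetricOverDiagonal n a →
  ∀ m → 1 + suc m ≡ n → Palindromic m (diagonal a 1)
sod⇒palindromic-diagonal₁ {a = a} sod m refl i j refl = begin
  a (suc i) (suc i + 1)                          ≡⟨ sod (suc i) (s≤s z≤n) (s≤s (m≤m+n i j)) ⟩
  a (suc (i + j) ∸ i) (suc (i + j) ∸ i + 1)      ≡⟨ cong (λ k → a k (k + 1)) [i+j]+1∸i≡j+1 ⟩
  a (suc j) (suc j + 1)                          ∎
  where
  [i+j]+1∸i≡j+1 : suc (i + j) ∸ i ≡ suc j
  [i+j]+1∸i≡j+1 = trans (cong (_∸ i) (sym (+-suc i j))) (m+n∸m≡n i (suc j))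

ds⇒sod : DoublySymmetric n a → SymmetricOverDiagonal n a
ds⇒sod {zero}  _  (suc _) _   ()
ds⇒sod {suc n} {a} ds i 1≤i i≤n = begin
  a i (i + 1)                      ≡⟨ cong (a i) (+-comm i 1) ⟩
  a i (suc i)                      ≡⟨ proj₁ reflected ⟩
  a (suc i) i                      ≡⟨ proj₂ reflected ⟩
  a (n ∸ i + 1) (suc n ∸ i + 1)    ≡⟨ cong (λ k → a k (suc n ∸ i + 1)) n∸i+1≡1+n∸i ⟩
  a (suc n ∸ i) (suc n ∸ i + 1)    ∎
  where
  reflected : (a i (suc i) ≡ a (suc i) i) × (a (suc i) i ≡ a (n ∸ i + 1) (suc n ∸ i + 1))
  reflected = ds i (suc i) 1≤i (m≤n⇒m≤1+n i≤n) (s≤s z≤n) (s≤s i≤n)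
  n∸i+1≡1+n∸i : n ∸ i + 1 ≡ suc n ∸ i
  n∸i+1≡1+n∸i = trans (sym (+-∸-comm 1 i≤n)) (cong (_∸ i) (+-comm n 1))

antidiagonal-zero⇒centre : AntiDiagonalZero n a → ∀ {d m} → 1 ≤ d → d + suc (suc m) ≡ n →
  VanishesAtCentre m (diagonal a (suc d))
antidiagonal-zero⇒centre {a = a} adz {suc e} _ refl p refl = begin
  diagonal a (suc (suc e)) p                           ≡⟨ cong (a (suc p)) (antidiagonal-column e p) ⟨
  a (suc p) (suc e + suc (suc (p + p)) ∸ suc p + 1)    ≡⟨ adz (suc p) (s≤s z≤n) (antidiagonal-row⁻¹ e p) ⟩
  false                                                ∎

module _ {n : ℕ} {a : Matrix} (S : IsSteinhaus n a) where
  open IsSteinhaus S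

  diagonal-difference : ∀ {d m} → 1 ≤ d → d + suc (suc m) ≡ n →
    IsDifferenceOn m (diagonal a d) (diagonal a (suc d))
  diagonal-difference {d} {m} 1≤d refl i i≤m = sym (begin
    x xor diagonal a d (suc i)  ≡⟨ cong (x xor_) steinhaus ⟩
    x xor (x xor z)             ≡⟨ xor-assoc x x z ⟨
    (x xor x) xor z             ≡⟨ cong (_xor z) (xor-same x) ⟩
    z                           ≡⟨ cong (λ k → a (suc i) (suc k)) (+-suc i d) ⟨
    diagonal a (suc d) i        ∎)
    where
    x z : Bool
    x = diagonal a d i
    z = a (suc i) (suc (suc i) + d)
    bound : suc (suc i) + d ≤ d + suc (suc m)
    bound = ≤-trans (≤-reflexive (+-comm (suc (suc i)) d)) (+-monoʳ-≤ d (s≤s (s≤s i≤m)))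
    steinhaus : diagonal a d (suc i) ≡ x xor z
    steinhaus = rule (suc (suc i)) (suc (suc i) + d) (s≤s (s≤s z≤n)) (m<m+n (suc (suc i)) 1≤d) bound

  palindromic-diagonals : (∀ m → 1 + suc m ≡ n → Palindromic m (diagonal a 1)) →
    PalindromicDiagonals n a
  palindromic-diagonals p₁ (suc zero) m _ e = p₁ m e
  palindromic-diagonals p₁ (suc (suc d)) m _ e =
    palindromic-difference (diagonal-difference (s≤s z≤n) e′)
      (palindromic-diagonals p₁ (suc d) (suc m) (s≤s z≤n) e′)
    where
    e′ : suc d + suc (suc m) ≡ n
    e′ = trans (cong suc (+-suc d (suc m))) e

  antidiagonal-zero⇒palindromic-diagonals : AntiDiagonalZero n a → PalindromicDiagonals n a
  antidiagonal-zero⇒palindromic-diagonals adz d zero _ _ = palindromic-zero (diagonal a d)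
  antidiagonal-zero⇒palindromic-diagonals adz d (suc m) 1≤d e =
    palindromic-integrate (diagonal-difference 1≤d e)
      (antidiagonal-zero⇒palindromic-diagonals adz (suc d) m (s≤s z≤n) (trans (sym (+-suc d (suc m))) e))
      (antidiagonal-zero⇒centre {a = a} adz 1≤d e)

  palindromic-diagonals⇒antidiagonal-zero : PalindromicDiagonals n a → AntiDiagonalZero n a
  palindromic-diagonals⇒antidiagonal-zero pal (suc p) _ p+1≤[n-1]/2 with antidiagonal-row {n = n} p+1≤[n-1]/2
  ... | e , refl = begin
    a (suc p) (suc e + suc (suc (p + p)) ∸ suc p + 1)  ≡⟨ cong (a (suc p)) (antidiagonal-column e p) ⟩
    diagonal a (suc (suc e)) p                         ≡⟨ palindromic-centre (diagonal-difference (s≤s z≤n) refl)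
                                                            (pal (suc e) (suc (p + p)) (s≤s z≤n) refl) p refl ⟩
    false                                              ∎

  reflect-above-diagonal : PalindromicDiagonals n a →
    ∀ i j → 1 ≤ i → i < j → j ≤ n → a i j ≡ a (n ∸ j + 1) (n ∸ i + 1)
  reflect-above-diagonal pal (suc p) j _ i<j j≤n
    with m≤n⇒∃[o]m+o≡n i<j | m≤n⇒∃[o]m+o≡n j≤n
  ... | k , refl | r , refl = begin
    a (suc p) (suc (suc p) + k)  ≡⟨ cong (a (suc p)) (+-suc (suc p) k) ⟨
    diagonal a (suc k) p         ≡⟨ pal (suc k) (p + r) (s≤s z≤n) (diagonal-length p k r) p r refl ⟩
    diagonal a (suc k) r         ≡⟨ cong₂ a (m+n∸m+1≡1+n (suc (suc p) + k) r) reflected-column ⟨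
    a (n ∸ j + 1) (n ∸ suc p + 1) ∎
    where
    diagonal-length : ∀ p k r → suc k + suc (p + r) ≡ suc (suc p) + k + r
    diagonal-length = solve-∀
    split-n : ∀ p k r → suc (suc p) + k + r ≡ suc p + suc (k + r)
    split-n = solve-∀
    regroup : ∀ k r → suc (suc (k + r)) ≡ suc r + suc k
    regroup = solve-∀
    reflected-column : n ∸ suc p + 1 ≡ suc r + suc k
    reflected-column = trans (cong (λ x → x ∸ suc p + 1) (split-n p k r))
                             (trans (m+n∸m+1≡1+n (suc p) (suc (k + r))) (regroup k r))

  palindromic-diagonals⇒ds : PalindromicDiagonals n a → DoublySymmetric n a
  palindromic-diagonals⇒ds pal i j 1≤i i≤n 1≤j j≤n = symm i j 1≤i i≤n 1≤j j≤n , reflect (<-cmp i j)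
    where
    i′ : 1 ≤ n ∸ i + 1 × n ∸ i + 1 ≤ n
    i′ = reflect-bounds 1≤i i≤n
    j′ : 1 ≤ n ∸ j + 1 × n ∸ j + 1 ≤ n
    j′ = reflect-bounds 1≤j j≤n
    reflect : Tri (i < j) (i ≡ j) (j < i) → a j i ≡ a (n ∸ j + 1) (n ∸ i + 1)
    reflect (tri< i<j _ _) = trans (symm j i 1≤j j≤n 1≤i i≤n) (reflect-above-diagonal pal i j 1≤i i<j j≤n)
    reflect (tri≈ _ refl _) = trans (diag i 1≤i i≤n) (sym (diag _ (proj₁ i′) (proj₂ i′)))
    reflect (tri> _ _ j<i) = trans (reflect-above-diagonal pal j i 1≤j j<i i≤n)
                                   (symm _ _ (proj₁ i′) (proj₂ i′) (proj₁ j′) (proj₂ j′))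

proposition1 : (n : ℕ) → 3 ≤ n → (a : Matrix) → IsSteinhaus n a →
    (DoublySymmetric n a ⇔ SymmetricOverDiagonal n a) ×
    (SymmetricOverDiagonal n a ⇔ AntiDiagonalZero n a)
proposition1 n _ a S =
  mk⇔ ds⇒sod (palindromic-diagonals⇒ds S ∘ sod⇒palindromic-diagonals) ,
  mk⇔ (palindromic-diagonals⇒antidiagonal-zero S ∘ sod⇒palindromic-diagonals)
      (ds⇒sod ∘ palindromic-diagonals⇒ds S ∘ antidiagonal-zero⇒palindromic-diagonals S)
  where
  sod⇒palindromic-diagonals : SymmetricOverDiagonal n a → PalindromicDiagonals n a
  sod⇒palindromic-diagonals = palindromic-diagonals S ∘ sod⇒palindromic-diagonal₁ {a = a}
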